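{- For every graph $G$ and every vertex $x\in V(G)$, $\operatorname{evc}(G_x^+)\le \operatorname{evc}(G)+1$.
   Context: All graphs are finite, simple and undirected. The eternal vertex cover game on a graph $G$ with $k$ guards: the defender first places $k$ guards on vertices of $G$; then in each round the attacker chooses an edge $uv$ and the defender reconfigures: all guards move simultaneously, each guard either staying or moving to an adjacent vertex, and at least one guard must move along the attacked edge from one endpoint to the other. Two versions are considered: any number of guards per vertex allowed, or at most one guard per vertex in every configuration; the claim holds for each version. $\operatorname{evc}(G)$ is the minimum $k$ such that the defender can defend every infinite sequence of attacks on $G$ with $k$ guards. $G_x^+$ denotes the graph obtained from $G$ by adding one new vertex adjacent only to $x$. -}

module Defs where

open import Data.Nat using (ℕ; zero; suc; _≤_)
open import Data.Fin using (Fin; zero; suc; _≟_)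
open import Data.Bool using (Bool; true; false)
open import Data.Unit using (⊤)
open import Data.List using (List; []; _∷_)
open import Data.Product using (Σ; ∃; _×_; _,_)
open import Data.Sum using (_⊎_)
open import Relation.Nullary.Decidable using (⌊_⌋)
open import Relation.Binary.PropositionalEquality using (_≡_; refl)
open import Function.Definitions using (Injective)

record Graph : Set where
  field
    n      : ℕ
    adj    : Fin n → Fin n → Bool
    sym    : ∀ u v → adj u v ≡ adj v u
    irrefl : ∀ v → adj v v ≡ false
open Graph public

-- G_x^+ : add a new vertex (index zero) adjacent only to x;
-- old vertex v becomes suc v.
pendAdj : (G : Graph) → Fin (n G) → Fin (suc (n G)) → Fin (suc (n G)) → Bool
pendAdj G x zero    zero    = false
pendAdj G x zero    (suc v) = ⌊ v ≟ x ⌋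
pendAdj G x (suc u) zero    = ⌊ u ≟ x ⌋
pendAdj G x (suc u) (suc v) = adj G u v

pendSym : (G : Graph) (x : Fin (n G)) → ∀ u v → pendAdj G x u v ≡ pendAdj G x v u
pendSym G x zero    zero    = refl
pendSym G x zero    (suc v) = refl
pendSym G x (suc u) zero    = refl
pendSym G x (suc u) (suc v) = sym G u v

pendIrr : (G : Graph) (x : Fin (n G)) → ∀ v → pendAdj G x v v ≡ false
pendIrr G x zero    = refl
pendIrr G x (suc v) = irrefl G v

_⁺_ : (G : Graph) → Fin (n G) → Graph
G ⁺ x = record { n = suc (n G) ; adj = pendAdj G x ; sym = pendSym G x ; irrefl = pendIrr G x }

-- An edge uv (given by an ordered pair of adjacent vertices; uv and vu
-- are the same edge, and the defence condition below is symmetric).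
Edge : Graph → Set
Edge G = Σ (Fin (n G)) λ u → Σ (Fin (n G)) λ v → adj G u v ≡ true

Config : Graph → ℕ → Set
Config G k = Fin k → Fin (n G)

data Version : Set where
  multiple : Version
  single   : Version

Allowed : (ver : Version) (G : Graph) (k : ℕ) → Config G k → Set
Allowed multiple G k C = ⊤
Allowed single   G k C = Injective _≡_ _≡_ C

Defends : (G : Graph) (k : ℕ) → Config G k → Edge G → Config G k → Set
Defends G k C (u , v , _) C' =
  (∀ i → (C' i ≡ C i) ⊎ (adj G (C i) (C' i) ≡ true)) ×
  (∃ λ i → ((C i ≡ u) × (C' i ≡ v)) ⊎ ((C i ≡ v) × (C' i ≡ u)))

-- A defender strategy: a configuration for every finite history of
-- attacks (most recent attack first); the empty history gives the
-- initial placement.  It defends every infinite attack sequence iff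
-- every configuration is allowed and each response is legal.
WinningStrategy : Version → (G : Graph) (k : ℕ) → (List (Edge G) → Config G k) → Set
WinningStrategy ver G k σ =
  (∀ h → Allowed ver G k (σ h)) ×
  (∀ h e → Defends G k (σ h) e (σ (e ∷ h)))

CanDefend : Version → Graph → ℕ → Set
CanDefend ver G k = Σ (List (Edge G) → Config G k) (WinningStrategy ver G k)

IsEvc : Version → Graph → ℕ → Set
IsEvc ver G k = CanDefend ver G k × (∀ j → CanDefend ver G j → k ≤ j)

module Submission where

-- Take a winning strategy σ for k guards on G and add one spare guard.
-- The spare lives on the new leaf vertex ℓ or on the anchor x; the k
-- original guards follow σ, which only changes on attacks of edges of G.
--   * Attack on an edge of G: the σ-guards answer as σ does, and the
--     spare returns to ℓ if it was on x (it never blocks a σ-guard).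
--   * Attack on the pendant edge ℓx: if the spare is on x it walks back to
--     ℓ; if it is on ℓ and no σ-guard stands on x it walks to x; otherwise
--     the spare and the σ-guard on x swap places, i.e. swap roles.
-- The spare only stands on x when no σ-guard does, so the single-guard
-- version is respected as well.  Because of the role swaps, the guards
-- are tracked as k+1 ROLES (role 0 = spare, role suc j = σ-guard j),
-- together with a permutation assigning roles to guards.

open import Defs
open import Data.Nat using (ℕ; suc; _≤_)
open import Data.Fin using (Fin; zero; suc; _≟_)
open import Data.Fin.Properties using (any?; suc-injective)
open import Data.Fin.Permutation
  using (Permutation′; _⟨$⟩ʳ_; _⟨$⟩ˡ_; inverseˡ; inverseʳ; id; transpose; _∘ₚ_)
open import Data.Bool using (true)
open import Data.Bool.Properties using (T-≡)
open import Data.Unit using (tt)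
open import Data.Empty using (⊥-elim)
open import Data.List using (List; []; _∷_)
open import Data.Product using (Σ; _×_; _,_; proj₁; proj₂; map₁)
open import Data.Sum using (_⊎_; inj₁; inj₂)
import Data.Sum as Sum
open import Relation.Nullary using (yes; no)
open import Relation.Nullary.Decidable using (toWitness; dec-true; isYes≗does)
open import Relation.Binary.PropositionalEquality
  using (_≡_; _≢_; refl; trans; cong; subst) renaming (sym to ≡-sym)
open import Function.Bundles using (Equivalence)
open import Function.Definitions using (Injective)

Move : (H : Graph) → Fin (n H) → Fin (n H) → Set
Move H a b = (b ≡ a) ⊎ (adj H a b ≡ true)

Crosses : (H : Graph) {K : ℕ} → Config H K → Config H K → Fin (n H) → Fin (n H) → Fin K → Set
Crosses H C C' u v i = ((C i ≡ u) × (C' i ≡ v)) ⊎ ((C i ≡ v) × (C' i ≡ u))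

relabel-defends : ∀ {H K} {C C' : Config H K} (e : Edge H) (π : Permutation′ K) →
  Defends H K C e C' → Defends H K (λ i → C (π ⟨$⟩ʳ i)) e (λ i → C' (π ⟨$⟩ʳ i))
relabel-defends {H} {C = C} {C'} (u , v , _) π (moves , r , crosses) =
  (λ i → moves (π ⟨$⟩ʳ i)) ,
  π ⟨$⟩ˡ r , subst (Crosses H C C' u v) (≡-sym (inverseʳ π)) crosses

relabel-allowed : ∀ ver {H K} {C : Config H K} (π : Permutation′ K) →
  Allowed ver H K C → Allowed ver H K (λ i → C (π ⟨$⟩ʳ i))
relabel-allowed multiple π _ = tt
relabel-allowed single π C-injective same =
  trans (≡-sym (inverseˡ π)) (trans (cong (π ⟨$⟩ˡ_) (C-injective same)) (inverseˡ π))

flip-defends : ∀ {H K} {C C' : Config H K} {u v} (a : adj H u v ≡ true) (b : adj H v u ≡ true) →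
  Defends H K C (u , v , a) C' → Defends H K C (v , u , b) C'
flip-defends _ _ (moves , i , crosses) = moves , i , Sum.swap crosses

transpose-cases : ∀ {K} (i j k : Fin K) →
  ((k ≡ i) × (transpose i j ⟨$⟩ʳ k ≡ j)) ⊎
  ((k ≡ j) × (transpose i j ⟨$⟩ʳ k ≡ i)) ⊎
  (transpose i j ⟨$⟩ʳ k ≡ k)
transpose-cases i j k with k ≟ i
... | yes k≡i = inj₁ (k≡i , refl)
... | no _ with k ≟ j
...   | yes k≡j = inj₂ (inj₁ (k≡j , refl))
...   | no _ = inj₂ (inj₂ refl)

transpose-matchˡ : ∀ {K} (i j : Fin K) → transpose i j ⟨$⟩ʳ i ≡ j
transpose-matchˡ i j rewrite dec-true (i ≟ i) refl = refl

swap-defends : ∀ {H K} (P : Config H K) {i j : Fin K} {u v} →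
  P i ≡ u → P j ≡ v → (a : adj H u v ≡ true) →
  Defends H K P (u , v , a) (λ k → P (transpose i j ⟨$⟩ʳ k))
swap-defends {H} P {i} {j} refl refl a = moves , i , inj₁ (refl , cong P (transpose-matchˡ i j))
  where
  moves : ∀ k → Move H (P k) (P (transpose i j ⟨$⟩ʳ k))
  moves k with transpose-cases i j k
  ... | inj₁ (refl , τk≡j) rewrite τk≡j = inj₂ a
  ... | inj₂ (inj₁ (refl , τk≡i)) rewrite τk≡i = inj₂ (trans (sym H (P j) (P i)) a)
  ... | inj₂ (inj₂ τk≡k) = inj₁ (cong P τk≡k)

single-move-defends : ∀ {H K} {C C' : Config H K} (i : Fin K) {u v} →
  (∀ k → k ≢ i → C' k ≡ C k) → C i ≡ u → C' i ≡ v → (a : adj H u v ≡ true) →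
  Defends H K C (u , v , a) C'
single-move-defends {H} {C = C} {C'} i stay refl refl a = moves , i , inj₁ (refl , refl)
  where
  moves : ∀ k → Move H (C k) (C' k)
  moves k with k ≟ i
  ... | yes refl = inj₂ a
  ... | no k≢i = inj₁ (stay k k≢i)

module SpareGuard (ver : Version) (G : Graph) (x : Fin (n G)) (k : ℕ)
  (σ : List (Edge G) → Config G k) (win : WinningStrategy ver G k σ) where

  K : ℕ
  K = suc k

  G⁺ : Graph
  G⁺ = G ⁺ x

  leaf-adj : adj G⁺ zero (suc x) ≡ true
  leaf-adj = trans (isYes≗does (x ≟ x)) (dec-true (x ≟ x) refl)

  anchor-adj : adj G⁺ (suc x) zero ≡ true
  anchor-adj = leaf-adj

  leaf-neighbour : ∀ {v} → adj G⁺ zero (suc v) ≡ true → v ≡ x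
  leaf-neighbour a = toWitness (Equivalence.from T-≡ a)

  liftEdge : Edge G → Edge G⁺
  liftEdge (u , v , a) = suc u , suc v , a

  data SparePlace (h : List (Edge G)) : Set where
    atLeaf   : SparePlace h
    atAnchor : (∀ j → σ h j ≢ x) → SparePlace h

  RoleState : Set
  RoleState = Σ (List (Edge G)) SparePlace

  place : RoleState → Config G⁺ K
  place (h , _)          (suc j) = suc (σ h j)
  place (h , atLeaf)     zero    = zero
  place (h , atAnchor _) zero    = suc x

  place-injective : ∀ h (s : SparePlace h) →
    Injective _≡_ _≡_ (σ h) → Injective _≡_ _≡_ (place (h , s))
  place-injective _ _            _   {zero}  {zero}  _    = refl
  place-injective _ _            inj {suc i} {suc j} same = cong suc (inj (suc-injective same))
  place-injective _ atLeaf       _   {zero}  {suc _} ()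
  place-injective _ atLeaf       _   {suc _} {zero}  ()
  place-injective _ (atAnchor off) _ {zero}  {suc j} same = ⊥-elim (off j (≡-sym (suc-injective same)))
  place-injective _ (atAnchor off) _ {suc i} {zero}  same = ⊥-elim (off i (suc-injective same))

  place-allowed : ∀ rs → Allowed ver G⁺ K (place rs)
  place-allowed (h , s) = lift ver (proj₁ win h)
    where
    lift : ∀ v → Allowed v G k (σ h) → Allowed v G⁺ K (place (h , s))
    lift multiple _   = tt
    lift single   inj = place-injective h s inj

  spare-returns : ∀ h (s : SparePlace h) → Move G⁺ (place (h , s) zero) zero
  spare-returns h atLeaf       = inj₁ refl
  spare-returns h (atAnchor _) = inj₂ anchor-adj

  lift-defends : ∀ h (s : SparePlace h) (e : Edge G) →
    Defends G⁺ K (place (h , s)) (liftEdge e) (place (e ∷ h , atLeaf))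
  lift-defends h s e with proj₂ win h e
  ... | moves , j , crosses = moves⁺ , suc j , Sum.map both-suc both-suc crosses
    where
    both-suc : ∀ {a b c d : Fin (n G)} → (a ≡ b) × (c ≡ d) → (suc a ≡ suc b) × (suc c ≡ suc d)
    both-suc (p , q) = cong suc p , cong suc q

    moves⁺ : ∀ r → Move G⁺ (place (h , s) r) (place (e ∷ h , atLeaf) r)
    moves⁺ (suc i) = Sum.map₁ (cong suc) (moves i)
    moves⁺ zero    = spare-returns h s

  others-unchanged : ∀ h (s s' : SparePlace h) r → r ≢ zero → place (h , s') r ≡ place (h , s) r
  others-unchanged h s s' zero    r≢0 = ⊥-elim (r≢0 refl)
  others-unchanged h s s' (suc j) _   = refl

  pendantResponse : ∀ h → SparePlace h → SparePlace h × Permutation′ K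
  pendantResponse h (atAnchor _) = atLeaf , id
  pendantResponse h atLeaf with any? (λ j → σ h j ≟ x)
  ... | yes (j , _) = atLeaf , transpose zero (suc j)
  ... | no none     = atAnchor (λ j onX → none (j , onX)) , id

  pendant-defends : ∀ h s →
    Defends G⁺ K (place (h , s)) (zero , suc x , leaf-adj)
      (λ r → place (h , proj₁ (pendantResponse h s)) (proj₂ (pendantResponse h s) ⟨$⟩ʳ r))
  pendant-defends h (atAnchor off) =
    flip-defends {G⁺} anchor-adj leaf-adj
      (single-move-defends {G⁺} zero (others-unchanged h (atAnchor off) atLeaf) refl refl anchor-adj)
  pendant-defends h atLeaf with any? (λ j → σ h j ≟ x)
  ... | yes (j , onX) = swap-defends {G⁺} (place (h , atLeaf)) refl (cong suc onX) leaf-adj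
  ... | no none       =
    single-move-defends {G⁺} zero (others-unchanged h atLeaf _) refl refl leaf-adj

  respond : RoleState → Edge G⁺ → RoleState × Permutation′ K
  respond _       (zero  , zero  , ())
  respond (h , s) (zero  , suc _ , _) = map₁ (h ,_) (pendantResponse h s)
  respond (h , s) (suc _ , zero  , _) = map₁ (h ,_) (pendantResponse h s)
  respond (h , s) (suc u , suc v , a) = ((u , v , a) ∷ h , atLeaf) , id

  respond-defends : ∀ rs e →
    Defends G⁺ K (place rs) e (λ r → place (proj₁ (respond rs e)) (proj₂ (respond rs e) ⟨$⟩ʳ r))
  respond-defends _       (zero  , zero  , ())
  respond-defends (h , s) (zero  , suc v , a) with refl ← leaf-neighbour a = pendant-defends h s
  respond-defends (h , s) (suc u , zero  , a) with refl ← leaf-neighbour a =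
    flip-defends {G⁺} leaf-adj a (pendant-defends h s)
  respond-defends (h , s) (suc u , suc v , a) = lift-defends h s (u , v , a)

  run : List (Edge G⁺) → RoleState × Permutation′ K
  run []       = ([] , atLeaf) , id
  run (e ∷ es) = proj₁ answer , proj₂ (run es) ∘ₚ proj₂ answer
    where
    answer : RoleState × Permutation′ K
    answer = respond (proj₁ (run es)) e

  strategy : List (Edge G⁺) → Config G⁺ K
  strategy es i = place (proj₁ (run es)) (proj₂ (run es) ⟨$⟩ʳ i)

  canDefend : CanDefend ver G⁺ K
  canDefend = strategy ,
    (λ es → relabel-allowed ver (proj₂ (run es)) (place-allowed (proj₁ (run es)))) ,
    (λ es e → relabel-defends {G⁺} e (proj₂ (run es)) (respond-defends (proj₁ (run es)) e))

mainTheorem4 : (ver : Version) (G : Graph) (x : Fin (n G)) (k k⁺ : ℕ) →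
    IsEvc ver G k → IsEvc ver (G ⁺ x) k⁺ → k⁺ ≤ suc k
mainTheorem4 ver G x k k⁺ ((σ , win) , _) (_ , minimal) =
  minimal (suc k) (SpareGuard.canDefend ver G x k σ win)
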